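{- Let $s$ be any clique size. In the batched dynamic network model described in the context, allowing node insertions, node deletions and edge deletions (but not edge insertions other than those incident to inserted nodes), the deterministic $1$-round bandwidth complexity of $\mathsf{BatchedList}(K_s)$ is $O(\log n)$, where $n$ is the current number of nodes. That is, there is a deterministic algorithm in which each node sends each neighbor $O(\log n)$ bits per round, and after the single round of communication following each batch of updates every $s$-clique of the current graph is listed by at least one of its nodes and no set of $s$ nodes that is not an $s$-clique of the current graph is listed.
   Context: Batched dynamic network model: the network is a sequence of graphs $(G_0, G_1, \dots, G_r)$, $G_i=(V_i,E_i)$. All nodes of $G_0$ know its complete topology. $G_i$ is obtained from $G_{i-1}$ by a batch of updates of the allowed types (here: node insertions together with their incident edges, node deletions together with their incident edges, edge deletions) such that every node of $V_i$ is incident to at most $O(1)$ updates; in particular a newly inserted node has only newly inserted incident edges, hence $O(1)$ of them. Each node has a unique ID of $O(\log n)$ bits ($n$ the current number of nodes) and knows the IDs of its current neighbors. Communication is synchronous; each round: (1) the batch of updates occurs and each node learns its new neighbor list; (2) each node sends each of its current neighbors a message of at most $B$ bits (the bandwidth); (3) nodes receive messages and output their lists. Deleted nodes send and list nothing. $K_s$ is the clique on $s$ vertices. $\mathsf{BatchedList}(H)$ is the problem, in this model, that in each round every subgraph of the current graph isomorphic to $H$ is listed (IDs of its nodes output) by at least one of its nodes, and every listed set is such a subgraph. The deterministic $1$-round bandwidth complexity is the minimum $B$ for which a deterministic algorithm has correct output at every node after one round of communication following each batch. -}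

module Defs where

open import Data.Bool using (Bool; true; false; if_then_else_; _∧_; not)
open import Data.Nat using (ℕ; zero; suc; _+_; _*_; _^_; _≤_; _<_; _≡ᵇ_)
open import Data.Nat.Logarithm using (⌊log₂_⌋)
open import Data.List using (List; []; _∷_; filterᵇ; length; map)
open import Data.Bool.ListAction using (any)
open import Data.List.Membership.Propositional using (_∈_)
open import Data.List.Relation.Unary.All using (All)
open import Data.List.Relation.Unary.Linked using (Linked)
open import Data.List.Relation.Unary.Unique.Propositional using (Unique)
open import Data.List.Relation.Binary.Permutation.Propositional using (_↭_)
open import Data.Product using (Σ; ∃; _×_; _,_)
open import Data.Unit using (⊤)
open import Relation.Binary.PropositionalEquality using (_≡_; _≢_)

record Graph : Set where
  field
    nodes : List ℕ          -- the node IDs, listed in strictly increasing order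
    adj   : ℕ → ℕ → Bool
open Graph public

record WellFormed (G : Graph) : Set where
  field
    sorted   : Linked _<_ (nodes G)
    symm     : ∀ u v → adj G u v ≡ adj G v u
    irrefl   : ∀ v → adj G v v ≡ false
    inNodes  : ∀ u v → adj G u v ≡ true → (u ∈ nodes G) × (v ∈ nodes G)

_∈ᵇ_ : ℕ → List ℕ → Bool
v ∈ᵇ xs = any (λ u → u ≡ᵇ v) xs

size : Graph → ℕ
size G = length (nodes G)

nbrs : Graph → ℕ → List ℕ
nbrs G v = filterᵇ (λ u → adj G v u) (nodes G)

lost : Graph → Graph → ℕ → List ℕ
lost G G' v = filterᵇ (λ u → adj G v u ∧ not (adj G' v u)) (nodes G)

gained : Graph → Graph → ℕ → List ℕ
gained G G' v = filterᵇ (λ u → adj G' v u ∧ not (adj G v u)) (nodes G')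

updatesAt : Graph → Graph → ℕ → ℕ
updatesAt G G' v = (if v ∈ᵇ nodes G then 0 else 1) + length (lost G G' v) + length (gained G G' v)

-- G' arises from G by a batch of node insertions, node deletions and edge
-- deletions (no edge insertion between two pre-existing nodes), in which
-- every node of G' is incident to at most c updates.
ValidBatch : ℕ → Graph → Graph → Set
ValidBatch c G G' =
  (∀ u v → u ∈ nodes G → v ∈ nodes G → adj G' u v ≡ true → adj G u v ≡ true)
  × (∀ v → v ∈ nodes G' → updatesAt G G' v ≤ c)

-- every ID has O(log n) bits: at most cID * (⌊log₂ n⌋ + 1) bits
IDsBounded : ℕ → Graph → Set
IDsBounded cID G = ∀ v → v ∈ nodes G → v < 2 ^ (cID * suc ⌊log₂ size G ⌋)

GoodGraph : ℕ → Graph → Set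
GoodGraph cID G = WellFormed G × IDsBounded cID G

-- valid dynamic network G₀, G₁, …, G_r  (G₀ given separately, the rest as a list)
ValidSeq : ℕ → ℕ → Graph → List Graph → Set
ValidSeq c cID G []        = ⊤
ValidSeq c cID G (G' ∷ Gs) = GoodGraph cID G' × ValidBatch c G G' × ValidSeq c cID G' Gs

Message : Set
Message = List Bool

record Algorithm : Set₁ where
  field
    State   : Set
    -- initial state of a node of G₀ (knows the whole topology of G₀ and its own ID)
    init    : Graph → ℕ → State
    -- initial state of a newly inserted node (knows its own ID)
    fresh   : ℕ → State
    -- message sent by a node (state, own ID, current neighbour list) to the neighbour with given ID
    send    : State → ℕ → List ℕ → ℕ → Message
    -- new state from (state, own ID, current neighbour list, received (sender, message) pairs)
    receive : State → ℕ → List ℕ → List (ℕ × Message) → State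
    output  : State → List (List ℕ)
open Algorithm public

module Run (A : Algorithm) where

  -- state of node v at the start of the round for the batch G ↦ G'
  pre : Graph → (ℕ → State A) → ℕ → State A
  pre G σ v = if v ∈ᵇ nodes G then σ v else fresh A v

  msg : Graph → Graph → (ℕ → State A) → ℕ → ℕ → Message
  msg G G' σ u v = send A (pre G σ u) u (nbrs G' u) v

  -- states after the single round of communication following the batch G ↦ G'
  step : Graph → Graph → (ℕ → State A) → ℕ → State A
  step G G' σ v =
    receive A (pre G σ v) v (nbrs G' v) (map (λ u → u , msg G G' σ u v) (nbrs G' v))

IsClique : ℕ → Graph → List ℕ → Set
IsClique s G K =
  length K ≡ s × Unique K × All (_∈ nodes G) K
  × (∀ u w → u ∈ K → w ∈ K → u ≢ w → adj G u w ≡ true)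

CorrectListing : (A : Algorithm) → ℕ → Graph → (ℕ → State A) → Set
CorrectListing A s G σ =
  (∀ K → IsClique s G K → Σ ℕ λ v → v ∈ K × Σ (List ℕ) λ L → L ∈ output A (σ v) × L ↭ K)
  × (∀ v → v ∈ nodes G → ∀ L → L ∈ output A (σ v) → IsClique s G L)

BandwidthOK : (A : Algorithm) → ℕ → Graph → Graph → (ℕ → State A) → Set
BandwidthOK A C G G' σ =
  ∀ u v → u ∈ nodes G' → v ∈ nbrs G' u →
    length (Run.msg A G G' σ u v) ≤ C * suc ⌊log₂ size G' ⌋

GoodRun : (A : Algorithm) → ℕ → ℕ → Graph → (ℕ → State A) → List Graph → Set
GoodRun A s C G σ []        = ⊤
GoodRun A s C G σ (G' ∷ Gs) =
  BandwidthOK A C G G' σ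
  × CorrectListing A s G' (Run.step A G G' σ)
  × GoodRun A s C G' (Run.step A G G' σ) Gs

Solves : (A : Algorithm) → ℕ → ℕ → ℕ → ℕ → Set
Solves A s c cID C =
  ∀ (G₀ : Graph) (Gs : List Graph) → GoodGraph cID G₀ → ValidSeq c cID G₀ Gs →
    GoodRun A s C G₀ (init A G₀) Gs

{-# OPTIONS --safe #-}
module Submission where

-- Each node keeps its neighbour list and a table of the edges it believes in. Every round a node x
-- sends each neighbour the largest ID among its current neighbours, its lost neighbours up to that
-- bound, and its gained neighbours; with O(1) updates per node these are O(1) IDs, i.e. O(log n) bits.
-- From x's report a neighbour keeps a believed edge x–y if y is at most the bound and not reported
-- lost, and adds x–y if y is reported gained. Invariant: every clique K of the current graph has a
-- member v that knows every edge of K not at v. Since no edge is inserted between two old nodes, the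
-- old nodes of a new clique K form an old clique, whose witness v knew the old edges of K; every edge
-- x–y of K then reaches v through x's report. The witness lists K, the edges at v being in its
-- neighbour list.

open import Defs
open import Data.Bool using (Bool; true; false; not; _∧_; T; T?)
open import Data.Bool.Properties using (T-≡; T-∧)
open import Data.Nat using (ℕ; zero; suc; _+_; _*_; _^_; _≤_; _<_; _≟_; _≤?_; s≤s; z≤n)
open import Data.Nat.Binary using (ℕᵇ; zero; 2[1+_]; 1+[2_]; toℕ; fromℕ)
open import Data.Nat.Binary.Properties using (toℕ-fromℕ)
open import Data.Nat.Logarithm using (⌊log₂_⌋)
open import Data.Nat.Properties
open import Data.List using (List; []; _∷_; _++_; map; length; filter; take; drop; cartesianProductWith)
open import Data.List.Properties using (filter-none; length-filter; length-++)
open import Data.List.Extrema.Nat using (max; xs≤max; max<v⁺)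
open import Data.List.Membership.Propositional using (_∈_; _∉_; find; lose)
open import Data.List.Membership.Propositional.Properties
  using (∈-filter⁺; ∈-filter⁻; ∈-cartesianProductWith⁺; ∈-cartesianProductWith⁻)
open import Data.List.Membership.DecPropositional _≟_ using (_∈?_; _∉?_)
open import Data.List.Relation.Binary.Permutation.Propositional using (_↭_; ↭-refl)
open import Data.List.Relation.Binary.Sublist.Propositional using (_⊆_; []; _∷ʳ_) renaming (_∷_ to _∷ₛ_)
open import Data.List.Relation.Binary.Sublist.Heterogeneous.Properties using (length-mono-≤)
open import Data.List.Relation.Unary.All as All using (All; []; _∷_; all?)
open import Data.List.Relation.Unary.All.Properties using (all-filter; ++⁺; anti-mono)
open import Data.List.Relation.Unary.Any as Any using (here; there; any?)
open import Data.List.Relation.Unary.Any.Properties using (any⁺)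
open import Data.List.Relation.Unary.Unique.DecPropositional _≟_ using (Unique; unique?)
open import Data.Product using (Σ; ∃-syntax; _×_; _,_; proj₁; proj₂)
open import Data.Sum using (_⊎_; inj₁; inj₂)
open import Data.Unit using (tt)
open import Function using (_∘_)
open import Function.Bundles using (Equivalence)
open import Relation.Nullary using (Dec; yes; no; contradiction)
open import Relation.Nullary.Decidable using (⌊_⌋; _×-dec_; _⊎-dec_; toWitness; fromWitness)
open import Relation.Binary.PropositionalEquality

open Equivalence using (to; from)

take-length-++ : ∀ {A : Set} (xs ys : List A) → take (length xs) (xs ++ ys) ≡ xs
take-length-++ []       ys = refl
take-length-++ (x ∷ xs) ys = cong (x ∷_) (take-length-++ xs ys)

drop-length-++ : ∀ {A : Set} (xs ys : List A) → drop (length xs) (xs ++ ys) ≡ ys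
drop-length-++ []       ys = refl
drop-length-++ (x ∷ xs) ys = drop-length-++ xs ys

filter-filter-⊆ : ∀ {A : Set} {P Q R : A → Set}
  (P? : ∀ x → Dec (P x)) (Q? : ∀ x → Dec (Q x)) (R? : ∀ x → Dec (R x)) →
  (∀ {x} → Q x → P x → R x) → ∀ xs → filter P? (filter Q? xs) ⊆ filter R? xs
filter-filter-⊆ P? Q? R? QP⇒R []       = []
filter-filter-⊆ P? Q? R? QP⇒R (x ∷ xs) with Q? x | R? x
... | no _  | no _  = filter-filter-⊆ P? Q? R? QP⇒R xs
... | no _  | yes _ = x ∷ʳ filter-filter-⊆ P? Q? R? QP⇒R xs
... | yes q | r with P? x | r
...   | yes p | no ¬r = contradiction (QP⇒R q p) ¬r
...   | yes _ | yes _ = refl ∷ₛ filter-filter-⊆ P? Q? R? QP⇒R xs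
...   | no _  | no _  = filter-filter-⊆ P? Q? R? QP⇒R xs
...   | no _  | yes _ = x ∷ʳ filter-filter-⊆ P? Q? R? QP⇒R xs

tuples : ∀ {A : Set} → ℕ → List A → List (List A)
tuples zero    xs = [] ∷ []
tuples (suc k) xs = cartesianProductWith _∷_ xs (tuples k xs)

∈-tuples⁺ : ∀ {A : Set} {k} {xs L : List A} → length L ≡ k → All (_∈ xs) L → L ∈ tuples k xs
∈-tuples⁺ {k = zero}  {L = []}    refl []        = here refl
∈-tuples⁺ {k = suc k} {L = y ∷ L} eq   (y∈ ∷ L⊆) =
  ∈-cartesianProductWith⁺ _∷_ y∈ (∈-tuples⁺ (suc-injective eq) L⊆)

∈-tuples⁻ : ∀ {A : Set} k (xs : List A) {L} → L ∈ tuples k xs → length L ≡ k × All (_∈ xs) L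
∈-tuples⁻ zero    xs (here refl) = refl , []
∈-tuples⁻ (suc k) xs L∈
  with _ , L′ , y∈ , L′∈ , refl ← ∈-cartesianProductWith⁻ _∷_ xs (tuples k xs) L∈
  with eq , L′⊆ ← ∈-tuples⁻ k xs L′∈
  = cong suc eq , y∈ ∷ L′⊆

∈⇒∈ᵇ : ∀ {v xs} → v ∈ xs → T (v ∈ᵇ xs)
∈⇒∈ᵇ {v} v∈ = any⁺ _ (Any.map (λ { refl → ≡⇒≡ᵇ v v refl }) v∈)

-- Self-delimiting binary encoding of lists of naturals

bits : ℕᵇ → List Bool
bits zero     = []
bits 2[1+ x ] = true ∷ bits x
bits 1+[2 x ] = false ∷ bits x

unbits : List Bool → ℕᵇ
unbits []           = zero
unbits (true ∷ bs)  = 2[1+ unbits bs ]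
unbits (false ∷ bs) = 1+[2 unbits bs ]

unbits-bits : ∀ x → unbits (bits x) ≡ x
unbits-bits zero     = refl
unbits-bits 2[1+ x ] = cong 2[1+_] (unbits-bits x)
unbits-bits 1+[2 x ] = cong 1+[2_] (unbits-bits x)

2^length-bits≤1+toℕ : ∀ x → 2 ^ length (bits x) ≤ suc (toℕ x)
2^length-bits≤1+toℕ zero     = ≤-refl
2^length-bits≤1+toℕ 2[1+ x ] = m≤n⇒m≤1+n (*-monoʳ-≤ 2 (2^length-bits≤1+toℕ x))
2^length-bits≤1+toℕ 1+[2 x ] =
  ≤-trans (*-monoʳ-≤ 2 (2^length-bits≤1+toℕ x)) (≤-reflexive (*-suc 2 (toℕ x)))

length-bits≤ : ∀ x {k} → toℕ x < 2 ^ k → length (bits x) ≤ k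
length-bits≤ x {k} x<2^k = ≮⇒≥ λ k<l →
  <-irrefl refl (<-≤-trans (^-monoʳ-< 2 (s≤s (s≤s z≤n)) k<l) (≤-trans (2^length-bits≤1+toℕ x) x<2^k))

n<2^n : ∀ n → n < 2 ^ n
n<2^n zero    = s≤s z≤n
n<2^n (suc n) = +-mono-≤ (m^n>0 2 n) (≤-trans (n<2^n n) (m≤m+n (2 ^ n) 0))

frame : List Bool → List Bool
frame []       = false ∷ []
frame (b ∷ bs) = true ∷ b ∷ frame bs

consHead : Bool → List (List Bool) → List (List Bool)
consHead b []         = (b ∷ []) ∷ []
consHead b (bs ∷ bss) = (b ∷ bs) ∷ bss

unframe : List Bool → List (List Bool)
unframe []             = []
unframe (false ∷ r)    = [] ∷ unframe r
unframe (true ∷ [])    = []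
unframe (true ∷ b ∷ r) = consHead b (unframe r)

unframe-frame : ∀ bs r → unframe (frame bs ++ r) ≡ bs ∷ unframe r
unframe-frame []       r = refl
unframe-frame (b ∷ bs) r rewrite unframe-frame bs r = refl

length-frame : ∀ bs → length (frame bs) ≡ suc (length bs + length bs)
length-frame []       = refl
length-frame (b ∷ bs) rewrite length-frame bs | +-suc (length bs) (length bs) = refl

encodeℕs : List ℕ → List Bool
encodeℕs []       = []
encodeℕs (n ∷ ns) = frame (bits (fromℕ n)) ++ encodeℕs ns

decodeℕs : List Bool → List ℕ
decodeℕs bs = map (toℕ ∘ unbits) (unframe bs)

decodeℕs-encodeℕs : ∀ ns → decodeℕs (encodeℕs ns) ≡ ns
decodeℕs-encodeℕs []       = refl
decodeℕs-encodeℕs (n ∷ ns)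
  rewrite unframe-frame (bits (fromℕ n)) (encodeℕs ns) | unbits-bits (fromℕ n) | toℕ-fromℕ n
  = cong (n ∷_) (decodeℕs-encodeℕs ns)

length-encodeℕs : ∀ {k ns} → All (_< 2 ^ k) ns → length (encodeℕs ns) ≤ length ns * suc (k + k)
length-encodeℕs []                            = z≤n
length-encodeℕs {k} {n ∷ ns} (n<2^k ∷ ns<2^k) = begin
  length (frame (bits (fromℕ n)) ++ encodeℕs ns)         ≡⟨ length-++ (frame (bits (fromℕ n))) ⟩
  length (frame (bits (fromℕ n))) + length (encodeℕs ns) ≡⟨ cong (_+ _) (length-frame (bits (fromℕ n))) ⟩
  suc (l + l) + length (encodeℕs ns)                     ≤⟨ +-mono-≤ (s≤s (+-mono-≤ l≤k l≤k))
                                                                      (length-encodeℕs {k} ns<2^k) ⟩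
  suc (k + k) + length ns * suc (k + k)                  ∎
  where
    open ≤-Reasoning
    l = length (bits (fromℕ n))
    l≤k : l ≤ k
    l≤k = length-bits≤ (fromℕ n) (subst (_< 2 ^ k) (sym (toℕ-fromℕ n)) n<2^k)

record Report : Set where
  constructor report
  field
    bound    : ℕ
    departed : List ℕ
    arrived  : List ℕ
open Report

reportNumbers : Report → List ℕ
reportNumbers (report m ds as) = m ∷ length ds ∷ ds ++ as

fromNumbers : List ℕ → Report
fromNumbers (m ∷ k ∷ ns) = report m (take k ns) (drop k ns)
fromNumbers _            = report 0 [] []

encodeReport : Report → Message
encodeReport = encodeℕs ∘ reportNumbers

decodeReport : Message → Report
decodeReport = fromNumbers ∘ decodeℕs

decodeReport-encodeReport : ∀ r → decodeReport (encodeReport r) ≡ r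
decodeReport-encodeReport r@(report m ds as)
  rewrite decodeℕs-encodeℕs (reportNumbers r) | take-length-++ ds as | drop-length-++ ds as = refl

_∖_ : List ℕ → List ℕ → List ℕ
xs ∖ ys = filter (_∉? ys) xs

-- Lost neighbours above the bound may be deleted nodes with IDs too long for the current n;
-- they need not be sent, since a receiver only trusts "still adjacent" for IDs up to the bound.
reportOf : List ℕ → List ℕ → Report
reportOf old N = report (max 0 N) (filter (_≤? max 0 N) (old ∖ N)) (N ∖ old)

StillAdjacent : Report → ℕ → Set
StillAdjacent r y = y ≤ bound r × y ∉ departed r

Confirms : Bool → Report → ℕ → Set
Confirms believed r y = T believed × StillAdjacent r y ⊎ y ∈ arrived r

reportNumbers-< : ∀ {k} old N → All (_< 2 ^ k) N → length (departed (reportOf old N)) < 2 ^ k →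
  All (_< 2 ^ k) (reportNumbers (reportOf old N))
reportNumbers-< {k} old N N<2^k #departed<2^k =
  M<2^k ∷ #departed<2^k ∷
  ++⁺ (All.map (λ y≤M → ≤-<-trans y≤M M<2^k) (all-filter (_≤? max 0 N) (old ∖ N)))
      (anti-mono (λ y∈ → proj₁ (∈-filter⁻ (_∉? old) y∈)) N<2^k)
  where
    M<2^k : max 0 N < 2 ^ k
    M<2^k = max<v⁺ (m^n>0 2 k) N<2^k

messageFrom : ℕ → List (ℕ × Message) → Message
messageFrom x []             = []
messageFrom x ((u , m) ∷ ms) with u ≟ x
... | yes _ = m
... | no _  = messageFrom x ms

messageFrom-map : ∀ (f : ℕ → Message) {x us} → x ∈ us → messageFrom x (map (λ u → u , f u) us) ≡ f x
messageFrom-map f {x} {u ∷ us} x∈ with u ≟ x | x∈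
... | yes refl | _          = refl
... | no u≢x   | here x≡u   = contradiction (sym x≡u) u≢x
... | no _     | there x∈us = messageFrom-map f x∈us

∈-nbrs⁻ : ∀ G {v x} → x ∈ nbrs G v → x ∈ nodes G × adj G v x ≡ true
∈-nbrs⁻ G {v} x∈ with x∈G , t ← ∈-filter⁻ (T? ∘ adj G v) {xs = nodes G} x∈ = x∈G , to T-≡ t

module _ {G : Graph} (wf : WellFormed G) where

  ∈-nbrs⁺ : ∀ {v x} → adj G v x ≡ true → x ∈ nbrs G v
  ∈-nbrs⁺ {v} {x} e = ∈-filter⁺ (T? ∘ adj G v) (proj₂ (WellFormed.inNodes wf v x e)) (from T-≡ e)

  nbrs-outside : ∀ {v} → v ∉ nodes G → nbrs G v ≡ []
  nbrs-outside {v} v∉ = filter-none (T? ∘ adj G v) {xs = nodes G}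
    (All.tabulate λ {x} _ t → v∉ (proj₁ (WellFormed.inNodes wf v x (to T-≡ t))))

  adj-∉-nbrs : ∀ {H v w} → T (adj H v w) → w ∉ nbrs G v → T (adj H v w ∧ not (adj G v w))
  adj-∉-nbrs {H} {v} {w} t w∉ with adj G v w in e
  ... | true  = contradiction (∈-nbrs⁺ e) w∉
  ... | false = from T-∧ (t , tt)

module _ {G G′ : Graph} (wf : WellFormed G) (wf′ : WellFormed G′) {x : ℕ} where

  private
    N = nbrs G′ x
    r = reportOf (nbrs G x) N

  stillAdjacent-sound : ∀ {y} → adj G x y ≡ true → StillAdjacent r y → adj G′ x y ≡ true
  stillAdjacent-sound {y} e (y≤M , y∉departed) with y ∈? N
  ... | yes y∈N = proj₂ (∈-nbrs⁻ G′ y∈N)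
  ... | no  y∉N = contradiction (∈-filter⁺ (_≤? bound r) {xs = nbrs G x ∖ N} y∈lost y≤M) y∉departed
    where y∈lost = ∈-filter⁺ (_∉? N) (∈-nbrs⁺ wf e) y∉N

  stillAdjacent-complete : ∀ {y} → adj G′ x y ≡ true → StillAdjacent r y
  stillAdjacent-complete e = All.lookup (xs≤max 0 N) y∈N , λ y∈departed →
    proj₂ (∈-filter⁻ (_∉? N) {xs = nbrs G x} (proj₁ (∈-filter⁻ (_≤? bound r) {xs = nbrs G x ∖ N} y∈departed))) y∈N
    where y∈N = ∈-nbrs⁺ wf′ e

  arrived-sound : ∀ {y} → y ∈ arrived r → adj G′ x y ≡ true
  arrived-sound y∈ = proj₂ (∈-nbrs⁻ G′ (proj₁ (∈-filter⁻ (_∉? nbrs G x) y∈)))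

  arrived-complete : ∀ {y} → adj G′ x y ≡ true → adj G x y ≡ false → y ∈ arrived r
  arrived-complete e′ e = ∈-filter⁺ (_∉? nbrs G x) (∈-nbrs⁺ wf′ e′)
    λ y∈ → contradiction (trans (sym e) (proj₂ (∈-nbrs⁻ G y∈))) λ ()

  confirms-sound : ∀ {b y} → (T b → adj G x y ≡ true) → Confirms b r y → adj G′ x y ≡ true
  confirms-sound sound (inj₁ (t , still)) = stillAdjacent-sound (sound t) still
  confirms-sound sound (inj₂ y∈arrived)   = arrived-sound y∈arrived

  confirms-complete : ∀ {b y} → (adj G x y ≡ true → T b) → adj G′ x y ≡ true → Confirms b r y
  confirms-complete {y = y} known e′ with adj G x y in e
  ... | true  = inj₁ (known refl , stillAdjacent-complete e′)
  ... | false = inj₂ (arrived-complete e′ e)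

  length-departed≤length-lost : length (departed r) ≤ length (lost G G′ x)
  length-departed≤length-lost = ≤-trans (length-filter (_≤? bound r) (nbrs G x ∖ N))
    (length-mono-≤ (filter-filter-⊆ (_∉? N) (T? ∘ adj G x) (T? ∘ λ w → adj G x w ∧ not (adj G′ x w))
      (adj-∉-nbrs wf′ {G}) (nodes G)))

  length-arrived≤length-gained : length (arrived r) ≤ length (gained G G′ x)
  length-arrived≤length-gained =
    length-mono-≤ (filter-filter-⊆ (_∉? nbrs G x) (T? ∘ adj G′ x) (T? ∘ λ w → adj G′ x w ∧ not (adj G x w))
      (adj-∉-nbrs wf {G′}) (nodes G′))

record NodeState : Set where
  constructor state
  field
    self       : ℕ
    neighbours : List ℕ
    knows      : ℕ → ℕ → Bool
open NodeState

Learns : NodeState → List ℕ → (ℕ → Report) → ℕ → ℕ → Set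
Learns σ N reportBy x y = x ∈ N × Confirms (knows σ x y) (reportBy x) y

learns? : ∀ σ N reportBy x y → Dec (Learns σ N reportBy x y)
learns? σ N reportBy x y = x ∈? N ×-dec
  ((T? (knows σ x y) ×-dec (y ≤? bound (reportBy x) ×-dec y ∉? departed (reportBy x)))
   ⊎-dec y ∈? arrived (reportBy x))

Vouched : NodeState → ℕ → ℕ → Set
Vouched τ x y = x ≡ y ⊎ x ≡ self τ ⊎ y ≡ self τ ⊎ T (knows τ x y)

Listable : NodeState → List ℕ → Set
Listable τ L = Unique L × All (λ x → All (Vouched τ x) L) L

listable? : ∀ τ L → Dec (Listable τ L)
listable? τ L = unique? L ×-dec
  all? (λ x → all? (λ y → x ≟ y ⊎-dec x ≟ self τ ⊎-dec y ≟ self τ ⊎-dec T? (knows τ x y)) L) L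

reportsIn : List (ℕ × Message) → ℕ → Report
reportsIn received u = decodeReport (messageFrom u received)

cliqueLister : ℕ → Algorithm
cliqueLister s = record
  { State   = NodeState
  ; init    = λ G v → state v (nbrs G v) (adj G)
  ; fresh   = λ v → state v [] (λ _ _ → false)
  ; send    = λ σ _ N _ → encodeReport (reportOf (neighbours σ) N)
  ; receive = λ σ v N received → state v N (λ x y → ⌊ learns? σ N (reportsIn received) x y ⌋)
  ; output  = λ τ → filter (listable? τ) (tuples s (self τ ∷ neighbours τ))
  }

Complete : Graph → List ℕ → Set
Complete G K = ∀ u w → u ∈ K → w ∈ K → u ≢ w → adj G u w ≡ true

KnowsEdges : NodeState → ℕ → Graph → List ℕ → Set
KnowsEdges τ v H K = ∀ {x y} → x ∈ K → y ∈ K → x ≢ v → y ≢ v → adj H x y ≡ true → T (knows τ x y)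

CliquesCovered : (ℕ → NodeState) → Graph → Set
CliquesCovered σ G =
  ∀ {K w} → w ∈ K → All (_∈ nodes G) K → Complete G K → ∃[ v ] v ∈ K × KnowsEdges (σ v) v G K

record Invariant (σ : ℕ → NodeState) (G : Graph) : Set where
  field
    self-id : ∀ v → self (σ v) ≡ v
    tracks  : ∀ v → neighbours (σ v) ≡ nbrs G v
    sound   : ∀ v {x y} → T (knows (σ v) x y) → adj G x y ≡ true
    covered : CliquesCovered σ G

InsertsNoOldEdge : Graph → Graph → Set
InsertsNoOldEdge G G′ = ∀ u v → u ∈ nodes G → v ∈ nodes G → adj G′ u v ≡ true → adj G u v ≡ true

oldPart : Graph → List ℕ → List ℕ
oldPart G K = filter (_∈? nodes G) K

oldPart-complete : ∀ {G G′ K} → InsertsNoOldEdge G G′ → Complete G′ K → Complete G (oldPart G K)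
oldPart-complete {G} noOldEdge complete a b a∈O b∈O a≢b
  with a∈K , a∈G ← ∈-filter⁻ (_∈? nodes G) a∈O
  with b∈K , b∈G ← ∈-filter⁻ (_∈? nodes G) b∈O
  = noOldEdge a b a∈G b∈G (complete a b a∈K b∈K a≢b)

knowsEdges-oldPart : ∀ {G τ v K} → WellFormed G → KnowsEdges τ v G (oldPart G K) → KnowsEdges τ v G K
knowsEdges-oldPart {G} wf known {x} {y} x∈K y∈K x≢v y≢v e = known
  (∈-filter⁺ (_∈? nodes G) x∈K (proj₁ (WellFormed.inNodes wf x y e)))
  (∈-filter⁺ (_∈? nodes G) y∈K (proj₂ (WellFormed.inNodes wf x y e))) x≢v y≢v e

per-number-bits≤ : ∀ a b l → suc ((a * suc l + b) + (a * suc l + b)) ≤ suc ((a + b) + (a + b)) * suc l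
per-number-bits≤ a b l = begin
  1 + (k + k)                                 ≤⟨ +-mono-≤ (s≤s (z≤n {l})) (+-mono-≤ k≤ k≤) ⟩
  suc l + ((a + b) * suc l + (a + b) * suc l) ≡⟨ cong (suc l +_) (sym (*-distribʳ-+ (suc l) (a + b) (a + b))) ⟩
  suc ((a + b) + (a + b)) * suc l             ∎
  where
    open ≤-Reasoning
    k = a * suc l + b
    k≤ : k ≤ (a + b) * suc l
    k≤ = ≤-trans (+-monoʳ-≤ (a * suc l) (m≤m*n b (suc l))) (≤-reflexive (sym (*-distribʳ-+ (suc l) a b)))

-- A report is at most 2 + 2c numbers, each below 2 ^ ((cID + c) L) and so framed in at most
-- 2 (cID + c) L + 1 bits, where L = ⌊log₂ n⌋ + 1.
messageBound : ℕ → ℕ → ℕ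
messageBound c cID = (2 + (c + c)) * suc ((cID + c) + (cID + c))

module _ (s : ℕ) where

  open Run (cliqueLister s)

  pre-inside : ∀ {G σ v} → v ∈ nodes G → pre G σ v ≡ σ v
  pre-inside {G} {σ} {v} v∈G with v ∈ᵇ nodes G | ∈⇒∈ᵇ {v} {nodes G} v∈G
  ... | true | _ = refl

  pre-neighbours : ∀ {G σ} → WellFormed G → (∀ v → neighbours (σ v) ≡ nbrs G v) →
    ∀ v → neighbours (pre G σ v) ≡ nbrs G v
  pre-neighbours {G} wf tracks v with v ∈ᵇ nodes G in e
  ... | true  = tracks v
  ... | false = sym (nbrs-outside wf λ v∈G → subst T e (∈⇒∈ᵇ v∈G))

  pre-sound : ∀ {G σ} → (∀ v {x y} → T (knows (σ v) x y) → adj G x y ≡ true) →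
    ∀ v {x y} → T (knows (pre G σ v) x y) → adj G x y ≡ true
  pre-sound {G} sound v with v ∈ᵇ nodes G
  ... | true  = sound v
  ... | false = λ ()

  module _ {G G′ σ} (wf : WellFormed G) (wf′ : WellFormed G′) (inv : Invariant σ G) where

    open Invariant inv

    private
      received : ℕ → List (ℕ × Message)
      received v = map (λ u → u , msg G G′ σ u v) (nbrs G′ v)

    received-report : ∀ {v x} → x ∈ nbrs G′ v →
      decodeReport (messageFrom x (received v)) ≡ reportOf (nbrs G x) (nbrs G′ x)
    received-report {v} {x} x∈N = begin
      decodeReport (messageFrom x (received v))
        ≡⟨ cong decodeReport (messageFrom-map (λ u → msg G G′ σ u v) x∈N) ⟩
      decodeReport (encodeReport (reportOf (neighbours (pre G σ x)) (nbrs G′ x)))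
        ≡⟨ decodeReport-encodeReport _ ⟩
      reportOf (neighbours (pre G σ x)) (nbrs G′ x)
        ≡⟨ cong (λ old → reportOf old (nbrs G′ x)) (pre-neighbours {σ = σ} wf tracks x) ⟩
      reportOf (nbrs G x) (nbrs G′ x) ∎
      where open ≡-Reasoning

    step-sound : ∀ v {x y} → T (knows (step G G′ σ v) x y) → adj G′ x y ≡ true
    step-sound v {x} {y} t
      with x∈N , confirmed ← toWitness {a? = learns? (pre G σ v) (nbrs G′ v) (reportsIn (received v)) x y} t =
      confirms-sound wf wf′ (pre-sound {G} {σ} sound v)
        (subst (λ r → Confirms _ r y) (received-report x∈N) confirmed)

    step-knows : ∀ {v K} → v ∈ K → Complete G′ K → KnowsEdges (pre G σ v) v G K →
      KnowsEdges (step G G′ σ v) v G′ K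
    step-knows {v} v∈K complete known {x} {y} x∈K y∈K x≢v y≢v e′ =
      fromWitness {a? = learns? (pre G σ v) (nbrs G′ v) (reportsIn (received v)) x y}
        (x∈N , subst (λ r → Confirms _ r y) (sym (received-report x∈N)) confirmed)
      where
        x∈N       = ∈-nbrs⁺ wf′ (complete v x v∈K x∈K (x≢v ∘ sym))
        confirmed = confirms-complete wf wf′ (known x∈K y∈K x≢v y≢v) e′

    old-edges-known : InsertsNoOldEdge G G′ → ∀ {K w} → w ∈ K → Complete G′ K →
      ∃[ v ] v ∈ K × KnowsEdges (pre G σ v) v G K
    old-edges-known noOldEdge {K} {w} w∈K complete with any? (_∈? nodes G) K
    ... | no noneOld = w , w∈K , λ {x} {y} x∈K _ _ _ e →
      contradiction (lose x∈K (proj₁ (WellFormed.inNodes wf x y e))) noneOld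
    ... | yes someOld
      with x₀ , x₀∈K , x₀∈G ← find someOld
      with v , v∈O , knowsO ← covered {oldPart G K} (∈-filter⁺ (_∈? nodes G) x₀∈K x₀∈G)
                                 (all-filter (_∈? nodes G) K) (oldPart-complete {G} {G′} noOldEdge complete)
      with v∈K , v∈G ← ∈-filter⁻ (_∈? nodes G) v∈O
      = v , v∈K , subst (λ τ → KnowsEdges τ v G K) (sym (pre-inside {G} {σ} {v} v∈G))
                    (knowsEdges-oldPart {τ = σ v} {K = K} wf knowsO)

    invariant-step : InsertsNoOldEdge G G′ → Invariant (step G G′ σ) G′
    invariant-step noOldEdge = record
      { self-id = λ _ → refl
      ; tracks  = λ _ → refl
      ; sound   = step-sound
      ; covered = λ w∈K _ complete →
          let v , v∈K , known = old-edges-known noOldEdge w∈K complete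
          in  v , v∈K , step-knows v∈K complete known
      }

  invariant-init : ∀ G₀ → Invariant (init (cliqueLister s) G₀) G₀
  invariant-init G₀ = record
    { self-id = λ _ → refl
    ; tracks  = λ _ → refl
    ; sound   = λ _ → to T-≡
    ; covered = λ {_} {w} w∈K _ _ → w , w∈K , λ _ _ _ _ → from T-≡
    }

  module _ {G σ} (wf : WellFormed G) (inv : Invariant σ G) where

    open Invariant inv

    listed-sound : ∀ {v L} → v ∈ nodes G → L ∈ output (cliqueLister s) (σ v) → IsClique s G L
    listed-sound {v} {L} v∈G L∈
      with L∈tuples , unique , vouched ← ∈-filter⁻ (listable? (σ v)) L∈
      with length≡s , L⊆ ← ∈-tuples⁻ s _ L∈tuples
      = length≡s , unique , All.map inG L⊆′ , adjacent
      where
        L⊆′ : All (_∈ v ∷ nbrs G v) L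
        L⊆′ = subst₂ (λ x xs → All (_∈ x ∷ xs) L) (self-id v) (tracks v) L⊆
        inG : ∀ {x} → x ∈ v ∷ nbrs G v → x ∈ nodes G
        inG (here refl) = v∈G
        inG (there x∈N) = proj₁ (∈-nbrs⁻ G x∈N)
        adjacent-to-v : ∀ {x} → x ∈ L → x ≢ v → adj G v x ≡ true
        adjacent-to-v x∈L x≢v with All.lookup L⊆′ x∈L
        ... | here x≡v  = contradiction x≡v x≢v
        ... | there x∈N = proj₂ (∈-nbrs⁻ G x∈N)
        adjacent : ∀ u w → u ∈ L → w ∈ L → u ≢ w → adj G u w ≡ true
        adjacent u w u∈L w∈L u≢w with All.lookup (All.lookup vouched u∈L) w∈L
        ... | inj₁ u≡w = contradiction u≡w u≢w
        ... | inj₂ (inj₁ u≡self) with refl ← trans u≡self (self-id v) = adjacent-to-v w∈L (u≢w ∘ sym)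
        ... | inj₂ (inj₂ (inj₁ w≡self)) with refl ← trans w≡self (self-id v) =
          trans (WellFormed.symm wf u w) (adjacent-to-v u∈L u≢w)
        ... | inj₂ (inj₂ (inj₂ known)) = sound v known

    listed-complete : 1 ≤ s → ∀ {K} → IsClique s G K →
      Σ ℕ λ v → v ∈ K × Σ (List ℕ) λ L → L ∈ output (cliqueLister s) (σ v) × L ↭ K
    listed-complete 1≤s {[]} (length≡s , _) = contradiction (subst (1 ≤_) (sym length≡s) 1≤s) λ ()
    listed-complete 1≤s {K@(_ ∷ _)} (length≡s , unique , K⊆G , complete)
      with v , v∈K , known ← covered (here refl) K⊆G complete
      = v , v∈K , K , ∈-filter⁺ (listable? (σ v)) K∈tuples listable , ↭-refl
      where
        near : ∀ {x} → x ∈ K → x ∈ v ∷ nbrs G v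
        near {x} x∈K with x ≟ v
        ... | yes refl = here refl
        ... | no  x≢v  = there (∈-nbrs⁺ wf (complete v x v∈K x∈K (x≢v ∘ sym)))
        K∈tuples : K ∈ tuples s (self (σ v) ∷ neighbours (σ v))
        K∈tuples = subst₂ (λ x xs → K ∈ tuples s (x ∷ xs)) (sym (self-id v)) (sym (tracks v))
          (∈-tuples⁺ length≡s (All.tabulate near))
        vouch : ∀ {x y} → x ∈ K → y ∈ K → Vouched (σ v) x y
        vouch {x} {y} x∈K y∈K with x ≟ y | x ≟ v | y ≟ v
        ... | yes x≡y | _       | _       = inj₁ x≡y
        ... | no _    | yes x≡v | _       = inj₂ (inj₁ (trans x≡v (sym (self-id v))))
        ... | no _    | no _    | yes y≡v = inj₂ (inj₂ (inj₁ (trans y≡v (sym (self-id v)))))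
        ... | no x≢y  | no x≢v  | no y≢v  = inj₂ (inj₂ (inj₂ (known x∈K y∈K x≢v y≢v (complete x y x∈K y∈K x≢y))))
        listable : Listable (σ v) K
        listable = unique , All.tabulate λ x∈K → All.tabulate (vouch x∈K)

    listing-correct : 1 ≤ s → CorrectListing (cliqueLister s) s G σ
    listing-correct 1≤s = (λ K → listed-complete 1≤s) , λ v v∈G L → listed-sound v∈G

  bandwidth-ok : ∀ {c cID G G′ σ} → WellFormed G → WellFormed G′ → IDsBounded cID G′ →
    (∀ v → v ∈ nodes G′ → updatesAt G G′ v ≤ c) → (∀ v → neighbours (σ v) ≡ nbrs G v) →
    BandwidthOK (cliqueLister s) (messageBound c cID) G G′ σ
  bandwidth-ok {c} {cID} {G} {G′} {σ} wf wf′ ids updates tracks u _ u∈G′ _ =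
    subst (λ old → length (encodeReport (reportOf old N)) ≤ messageBound c cID * L)
      (sym (pre-neighbours {σ = σ} wf tracks u)) encoding≤
    where
      open ≤-Reasoning
      l = ⌊log₂ size G′ ⌋
      L = suc l
      k = cID * L + c
      D = (cID + c) + (cID + c)
      N = nbrs G′ u
      r = reportOf (nbrs G u) N
      lost≤c : length (lost G G′ u) ≤ c
      lost≤c = ≤-trans (≤-trans (m≤n+m _ _) (m≤m+n _ (length (gained G G′ u)))) (updates u u∈G′)
      gained≤c : length (gained G G′ u) ≤ c
      gained≤c = ≤-trans (m≤n+m _ _) (updates u u∈G′)
      departed≤c : length (departed r) ≤ c
      departed≤c = ≤-trans (length-departed≤length-lost wf wf′) lost≤c
      count≤ : length (reportNumbers r) ≤ 2 + (c + c)
      count≤ = s≤s (s≤s (≤-trans (≤-reflexive (length-++ (departed r)))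
        (+-mono-≤ departed≤c (≤-trans (length-arrived≤length-gained wf wf′) gained≤c))))
      numbers< : All (_< 2 ^ k) (reportNumbers r)
      numbers< = reportNumbers-< {k} (nbrs G u) N
        (All.tabulate λ y∈N → <-≤-trans (ids _ (proj₁ (∈-nbrs⁻ G′ y∈N))) (^-monoʳ-≤ 2 (m≤m+n (cID * L) c)))
        (<-≤-trans (≤-<-trans departed≤c (n<2^n c)) (^-monoʳ-≤ 2 (m≤n+m c (cID * L))))
      encoding≤ : length (encodeReport r) ≤ messageBound c cID * L
      encoding≤ = begin
        length (encodeReport r)                            ≤⟨ length-encodeℕs {k} numbers< ⟩
        length (reportNumbers r) * suc (k + k)             ≤⟨ *-mono-≤ count≤ (per-number-bits≤ cID c l) ⟩
        (2 + (c + c)) * (suc D * L)                        ≡⟨ sym (*-assoc (2 + (c + c)) (suc D) L) ⟩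
        messageBound c cID * L                             ∎

  runs-correctly : ∀ {c cID G σ} → 1 ≤ s → ∀ Gs → WellFormed G → Invariant σ G → ValidSeq c cID G Gs →
    GoodRun (cliqueLister s) s (messageBound c cID) G σ Gs
  runs-correctly 1≤s []        _  _   _ = tt
  runs-correctly {c} {cID} 1≤s (G′ ∷ Gs) wf inv ((wf′ , ids′) , (noOldEdge , updates) , valid) =
    bandwidth-ok {c} {cID} wf wf′ ids′ updates (Invariant.tracks inv) ,
    listing-correct wf′ inv′ 1≤s ,
    runs-correctly 1≤s Gs wf′ inv′ valid
    where inv′ = invariant-step wf wf′ inv noOldEdge

theorem4 : (s c cID : ℕ) → 1 ≤ s →
    Σ ℕ λ C → Σ Algorithm λ A → Solves A s c cID C
theorem4 s c cID 1≤s =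
  messageBound c cID , cliqueLister s ,
  λ G₀ Gs (wf₀ , _) valid → runs-correctly s 1≤s Gs wf₀ (invariant-init s G₀) valid
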